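{- A finite set $X$ of linear $\lambda$-terms is erasable if and only if all terms in $X$ are closed.
   Context: Pure $\lambda$-calculus with $\beta$- and $\eta$-reduction, $\rightarrow^*_{\beta\eta}$ the reflexive-transitive closure of their union. A $\lambda$-term $M$ is linear if each of its free variables occurs exactly once in it and every subterm $\lambda x.M'$ is such that $x$ occurs in $M'$ and $M'$ is linear. $I=\lambda x.x$. A set $X$ of linear $\lambda$-terms is erasable if there exists a linear $\lambda$-term $\mathtt{E}_X$ such that $\mathtt{E}_X\,M\rightarrow^*_{\beta\eta}I$ for all $M\in X$. -}

module Defs where

open import Data.Nat using (ℕ; zero; suc; _+_; _≤_)
open import Data.Nat.Properties using (_≟_)
open import Data.Product using (Σ; _×_)
open import Data.Unit using (⊤)
open import Data.List using (List)
open import Data.List.Membership.Propositional using (_∈_)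
open import Relation.Binary.PropositionalEquality using (_≡_)
open import Relation.Binary.Construct.Closure.ReflexiveTransitive using (Star)
open import Relation.Nullary using (yes; no)

-- Pure λ-terms in de Bruijn notation (terms up to α-equivalence).
data Λ : Set where
  var : ℕ → Λ
  lam : Λ → Λ
  app : Λ → Λ → Λ

ext : (ℕ → ℕ) → ℕ → ℕ
ext ρ zero    = zero
ext ρ (suc i) = suc (ρ i)

rename : (ℕ → ℕ) → Λ → Λ
rename ρ (var i)   = var (ρ i)
rename ρ (lam M)   = lam (rename (ext ρ) M)
rename ρ (app M N) = app (rename ρ M) (rename ρ N)

exts : (ℕ → Λ) → ℕ → Λ
exts σ zero    = var zero
exts σ (suc i) = rename suc (σ i)

subst : (ℕ → Λ) → Λ → Λ
subst σ (var i)   = σ i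
subst σ (lam M)   = lam (subst (exts σ) M)
subst σ (app M N) = app (subst σ M) (subst σ N)

-- single substitution  M[0 := N]  (free indices > 0 are decremented)
sub0 : Λ → ℕ → Λ
sub0 N zero    = N
sub0 N (suc i) = var i

_[_] : Λ → Λ → Λ
M [ N ] = subst (sub0 N) M

infix 4 _⟶_
data _⟶_ : Λ → Λ → Set where
  β    : ∀ {M N} → app (lam M) N ⟶ M [ N ]
  -- η: λx. N x → N  with x not free in N (N is weakened by 'rename suc')
  η    : ∀ {N} → lam (app (rename suc N) (var zero)) ⟶ N
  ξlam : ∀ {M M'} → M ⟶ M' → lam M ⟶ lam M'
  ξl   : ∀ {M M' N} → M ⟶ M' → app M N ⟶ app M' N
  ξr   : ∀ {M N N'} → N ⟶ N' → app M N ⟶ app M N'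

infix 4 _⟶*_
_⟶*_ : Λ → Λ → Set
_⟶*_ = Star _⟶_

occ : ℕ → Λ → ℕ
occ i (var j) with i ≟ j
... | yes _ = 1
... | no  _ = 0
occ i (lam M)   = occ (suc i) M
occ i (app M N) = occ i M + occ i N

-- Linear terms: every free variable occurs exactly once (at most once,
-- since free = occurring), and every λx.M' has x occurring in M' and M' linear.
Linear : Λ → Set
Linear M = (∀ i → occ i M ≤ 1) × LamOK M
  where
  LamOK : Λ → Set
  LamOK (var i)   = ⊤
  LamOK (lam M')  = (1 ≤ occ zero M') × Linear M'
  LamOK (app P Q) = LamOK P × LamOK Q

Closed : Λ → Set
Closed M = ∀ i → occ i M ≡ 0

I : Λ
I = lam (var zero)

-- A (finite) set of terms, represented as a list.
Erasable : List Λ → Set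
Erasable X = Σ Λ (λ E → Linear E × (∀ {M} → M ∈ X → app E M ⟶* I))

-- Linear terms are relevant (every λ binds an occurrence), relevance is
-- preserved by βη-reduction, and along reductions of relevant terms no free
-- variable ever disappears. Since I is closed, a linear E with E M ⟶* I forces
-- M to be closed.
--
-- Conversely, a closed linear term M satisfies M I ⋯ I ⟶* I for some number n
-- of arguments: a closed linear application has a head redex whose contraction
-- shrinks the term and keeps it closed and linear, while a closed linear λx.B
-- other than I is fed one I, which keeps the size and removes a leading λ. As
-- I I ⟶ I, extra arguments do no harm, so λx. x I ⋯ I with the largest such n
-- erases every term of a finite set.
module Submission where

open import Defs
open import Data.Empty using (⊥-elim)
open import Data.List using (List; []; _∷_)
open import Data.List.Membership.Propositional using (_∈_)
open import Data.List.Relation.Unary.All using (All; []; _∷_; tabulate; lookup)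
open import Data.List.Relation.Unary.Any using (here; there)
open import Data.Nat using (ℕ; zero; suc; _+_; _*_; _⊔_; _≤_; _<_; z≤n; s≤s; _≤′_; ≤′-reflexive; ≤′-step)
open import Data.Nat.Properties
open import Data.Nat.Tactic.RingSolver using (solve-∀)
open import Data.Product using (∃-syntax; _×_; _,_; proj₁; proj₂)
open import Data.Sum using (_⊎_; inj₁; inj₂)
open import Data.Unit using (⊤; tt)
open import Function.Bundles using (_⇔_; mk⇔)
open import Function.Definitions using (Injective)
open import Relation.Binary.Construct.Closure.ReflexiveTransitive using (ε; _◅_; _◅◅_; gmap)
open import Relation.Binary.PropositionalEquality
  using (_≡_; _≢_; refl; sym; trans; cong; cong₂; module ≡-Reasoning)
  renaming (subst to transport)
open import Relation.Nullary using (yes; no; ¬_)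

infix 4 _∈FV_

_∈FV_ : ℕ → Λ → Set
i ∈FV M = 1 ≤ occ i M

occ-var-self : ∀ i → occ i (var i) ≡ 1
occ-var-self i with i ≟ i
... | yes _  = refl
... | no i≢i = ⊥-elim (i≢i refl)

occ-var-≢ : ∀ {i j} → j ≢ i → occ i (var j) ≡ 0
occ-var-≢ {i} {j} j≢i with i ≟ j
... | yes i≡j = ⊥-elim (j≢i (sym i≡j))
... | no _    = refl

occ-var-≤1 : ∀ i j → occ i (var j) ≤ 1
occ-var-≤1 i j with i ≟ j
... | yes _ = ≤-refl
... | no _  = z≤n

occ-var-injective : ∀ {ρ} → Injective _≡_ _≡_ ρ →
                    ∀ i j → occ (ρ i) (var (ρ j)) ≡ occ i (var j)
occ-var-injective {ρ} inj i j with i ≟ j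
... | yes refl = occ-var-self (ρ i)
... | no i≢j   = occ-var-≢ (λ ρj≡ρi → i≢j (sym (inj ρj≡ρi)))

occ-var-suc : ∀ i j → occ (suc i) (var (suc j)) ≡ occ i (var j)
occ-var-suc = occ-var-injective suc-injective

∈FV-app⁻ : ∀ {i} M N → i ∈FV app M N → i ∈FV M ⊎ i ∈FV N
∈FV-app⁻ {i} M N i∈ with occ i M
... | zero  = inj₂ i∈
... | suc _ = inj₁ (s≤s z≤n)

∈FV-appˡ : ∀ {i} M N → i ∈FV M → i ∈FV app M N
∈FV-appˡ {i} M N i∈ = ≤-trans i∈ (m≤m+n (occ i M) (occ i N))

∈FV-appʳ : ∀ {i} M N → i ∈FV N → i ∈FV app M N
∈FV-appʳ {i} M N i∈ = ≤-trans i∈ (m≤n+m (occ i N) (occ i M))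

Closed⇒∉FV : ∀ {M} → Closed M → ∀ {i} → ¬ i ∈FV M
Closed⇒∉FV closed {i} i∈ = n≮0 (transport (1 ≤_) (closed i) i∈)

¬Closed-var : ∀ {i} → ¬ Closed (var i)
¬Closed-var {i} closed = Closed⇒∉FV {var i} closed (≤-reflexive (sym (occ-var-self i)))

Closed-appˡ : ∀ {M N} → Closed (app M N) → Closed M
Closed-appˡ {M} closed i = m+n≡0⇒m≡0 (occ i M) (closed i)

Closed-appʳ : ∀ {M N} → Closed (app M N) → Closed N
Closed-appʳ {M} closed i = m+n≡0⇒n≡0 (occ i M) (closed i)

Closed-I : Closed I
Closed-I _ = refl

ext-injective : ∀ {ρ} → Injective _≡_ _≡_ ρ → Injective _≡_ _≡_ (ext ρ)
ext-injective inj {zero}  {zero}  _  = refl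
ext-injective inj {suc x} {suc y} eq = cong suc (inj (suc-injective eq))

occ-rename : ∀ {ρ} → Injective _≡_ _≡_ ρ → ∀ i N → occ (ρ i) (rename ρ N) ≡ occ i N
occ-rename inj i (var j)   = occ-var-injective inj i j
occ-rename inj i (lam N)   = occ-rename (ext-injective inj) (suc i) N
occ-rename inj i (app M N) = cong₂ _+_ (occ-rename inj i M) (occ-rename inj i N)

occ-rename-∉ : ∀ {ρ i} → (∀ x → ρ x ≢ i) → ∀ N → occ i (rename ρ N) ≡ 0
occ-rename-∉ miss (var j)   = occ-var-≢ (miss j)
occ-rename-∉ {ρ} {i} miss (lam N) = occ-rename-∉ ext-miss N
  where
  ext-miss : ∀ x → ext ρ x ≢ suc i
  ext-miss zero    ()
  ext-miss (suc x) eq = miss x (suc-injective eq)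
occ-rename-∉ miss (app M N) = cong₂ _+_ (occ-rename-∉ miss M) (occ-rename-∉ miss N)

occ-weaken : ∀ i N → occ (suc i) (rename suc N) ≡ occ i N
occ-weaken = occ-rename suc-injective

occ-weaken-zero : ∀ N → occ 0 (rename suc N) ≡ 0
occ-weaken-zero = occ-rename-∉ (λ _ ())

rename-id-on-FV : ∀ ρ N → (∀ i → i ∈FV N → ρ i ≡ i) → rename ρ N ≡ N
rename-id-on-FV ρ (var j)   fixes = cong var (fixes j (≤-reflexive (sym (occ-var-self j))))
rename-id-on-FV ρ (lam N)   fixes = cong lam (rename-id-on-FV (ext ρ) N ext-fixes)
  where
  ext-fixes : ∀ i → i ∈FV N → ext ρ i ≡ i
  ext-fixes zero    _  = refl
  ext-fixes (suc i) i∈ = cong suc (fixes i i∈)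
rename-id-on-FV ρ (app M N) fixes =
  cong₂ app (rename-id-on-FV ρ M (λ i i∈ → fixes i (∈FV-appˡ M N i∈)))
            (rename-id-on-FV ρ N (λ i i∈ → fixes i (∈FV-appʳ M N i∈)))

size : Λ → ℕ
size (var _)   = 1
size (lam M)   = suc (size M)
size (app M N) = suc (size M + size N)

size-rename : ∀ ρ N → size (rename ρ N) ≡ size N
size-rename ρ (var _)   = refl
size-rename ρ (lam N)   = cong suc (size-rename (ext ρ) N)
size-rename ρ (app M N) = cong suc (cong₂ _+_ (size-rename ρ M) (size-rename ρ N))

-- subst (subAt d Q) M is M with Q put for index d (under d binders, so Q is
-- weakened d times) and the indices above d decremented; M [ Q ] is d = 0.
subAt : ℕ → Λ → ℕ → Λ
subAt zero    Q = sub0 Q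
subAt (suc d) Q = exts (subAt d Q)

weaken : ℕ → Λ → Λ
weaken zero    Q = Q
weaken (suc d) Q = rename suc (weaken d Q)

punchIn : ℕ → ℕ → ℕ
punchIn zero    j       = suc j
punchIn (suc d) zero    = zero
punchIn (suc d) (suc j) = suc (punchIn d j)

subAt-var-or-weaken : ∀ d Q i → (∃[ k ] subAt d Q i ≡ var k) ⊎ subAt d Q i ≡ weaken d Q
subAt-var-or-weaken zero    Q zero    = inj₂ refl
subAt-var-or-weaken zero    Q (suc i) = inj₁ (i , refl)
subAt-var-or-weaken (suc d) Q zero    = inj₁ (0 , refl)
subAt-var-or-weaken (suc d) Q (suc i) with subAt-var-or-weaken d Q i
... | inj₁ (k , eq) = inj₁ (suc k , cong (rename suc) eq)
... | inj₂ eq       = inj₂ (cong (rename suc) eq)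

occ-subAt-var : ∀ d Q i j →
  occ j (subAt d Q i) ≡ occ (punchIn d j) (var i) + occ d (var i) * occ j (weaken d Q)
occ-subAt-var zero    Q zero    j       = sym (+-identityʳ (occ j Q))
occ-subAt-var zero    Q (suc i) j       = sym (trans (+-identityʳ _) (occ-var-suc j i))
occ-subAt-var (suc d) Q zero    zero    = refl
occ-subAt-var (suc d) Q zero    (suc j) = refl
occ-subAt-var (suc d) Q (suc i) zero
  rewrite occ-weaken-zero (subAt d Q i) | occ-weaken-zero (weaken d Q)
        | *-zeroʳ (occ (suc d) (var (suc i))) = refl
occ-subAt-var (suc d) Q (suc i) (suc j)
  rewrite occ-weaken j (subAt d Q i) | occ-weaken j (weaken d Q)
        | occ-var-suc (punchIn d j) i | occ-var-suc d i = occ-subAt-var d Q i j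

occ-subAt : ∀ d Q M j →
  occ j (subst (subAt d Q) M) ≡ occ (punchIn d j) M + occ d M * occ j (weaken d Q)
occ-subAt d Q (var i)   j = occ-subAt-var d Q i j
occ-subAt d Q (lam M)   j rewrite occ-subAt (suc d) Q M (suc j) | occ-weaken j (weaken d Q) = refl
occ-subAt d Q (app M N) j rewrite occ-subAt d Q M j | occ-subAt d Q N j =
  distribute (occ (punchIn d j) M) (occ d M) (occ (punchIn d j) N) (occ d N) (occ j (weaken d Q))
  where
  distribute : ∀ a b a′ b′ c → (a + b * c) + (a′ + b′ * c) ≡ (a + a′) + (b + b′) * c
  distribute = solve-∀

size-subAt-var : ∀ d Q i → size (subAt d Q i) + occ d (var i) ≡ 1 + occ d (var i) * size Q
size-subAt-var zero    Q zero    = trans (+-comm (size Q) 1) (cong suc (sym (+-identityʳ (size Q))))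
size-subAt-var zero    Q (suc i) = refl
size-subAt-var (suc d) Q zero    = refl
size-subAt-var (suc d) Q (suc i) rewrite size-rename suc (subAt d Q i) | occ-var-suc d i =
  size-subAt-var d Q i

size-subAt : ∀ d Q M → size (subst (subAt d Q) M) + occ d M ≡ size M + occ d M * size Q
size-subAt d Q (var i)   = size-subAt-var d Q i
size-subAt d Q (lam M)   = cong suc (size-subAt (suc d) Q M)
size-subAt d Q (app M N) = cong suc (begin
  (size M′ + size N′) + (a + b)      ≡⟨ interchange (size M′) (size N′) a b ⟩
  (size M′ + a) + (size N′ + b)      ≡⟨ cong₂ _+_ (size-subAt d Q M) (size-subAt d Q N) ⟩
  (size M + a * q) + (size N + b * q) ≡⟨ distribute (size M) (size N) a b q ⟩
  (size M + size N) + (a + b) * q    ∎)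
  where
  open ≡-Reasoning
  M′ = subst (subAt d Q) M
  N′ = subst (subAt d Q) N
  a = occ d M
  b = occ d N
  q = size Q
  interchange : ∀ x y u v → (x + y) + (u + v) ≡ (x + u) + (y + v)
  interchange = solve-∀
  distribute : ∀ x y u v w → (x + u * w) + (y + v * w) ≡ (x + y) + (u + v) * w
  distribute = solve-∀

-- Relevant terms

Linear-appˡ : ∀ {M N} → Linear (app M N) → Linear M
Linear-appˡ {M} {N} (bound , okM , _) = (λ i → ≤-trans (m≤m+n (occ i M) (occ i N)) (bound i)) , okM

Linear-appʳ : ∀ {M N} → Linear (app M N) → Linear N
Linear-appʳ {M} {N} (bound , _ , okN) = (λ i → ≤-trans (m≤n+m (occ i N) (occ i M)) (bound i)) , okN

Relevant : Λ → Set
Relevant (var _)   = ⊤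
Relevant (lam M)   = 0 ∈FV M × Relevant M
Relevant (app M N) = Relevant M × Relevant N

Linear⇒Relevant : ∀ M → Linear M → Relevant M
Linear⇒Relevant (var _)   _                   = tt
Linear⇒Relevant (lam M)   (_ , 0∈M , linearM) = 0∈M , Linear⇒Relevant M linearM
Linear⇒Relevant (app M N) linear =
  Linear⇒Relevant M (Linear-appˡ {M} {N} linear) , Linear⇒Relevant N (Linear-appʳ {M} {N} linear)

Relevant-rename : ∀ {ρ} → Injective _≡_ _≡_ ρ → ∀ N → Relevant N → Relevant (rename ρ N)
Relevant-rename inj (var _)   _ = tt
Relevant-rename inj (lam N)   (0∈N , relN) =
  transport (1 ≤_) (sym (occ-rename (ext-injective inj) 0 N)) 0∈N ,
  Relevant-rename (ext-injective inj) N relN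
Relevant-rename inj (app M N) (relM , relN) = Relevant-rename inj M relM , Relevant-rename inj N relN

Relevant-rename⁻ : ∀ {ρ} → Injective _≡_ _≡_ ρ → ∀ N → Relevant (rename ρ N) → Relevant N
Relevant-rename⁻ inj (var _)   _ = tt
Relevant-rename⁻ inj (lam N)   (0∈N , relN) =
  transport (1 ≤_) (occ-rename (ext-injective inj) 0 N) 0∈N ,
  Relevant-rename⁻ (ext-injective inj) N relN
Relevant-rename⁻ inj (app M N) (relM , relN) =
  Relevant-rename⁻ inj M relM , Relevant-rename⁻ inj N relN

Relevant-weaken : ∀ d Q → Relevant Q → Relevant (weaken d Q)
Relevant-weaken zero    Q relQ = relQ
Relevant-weaken (suc d) Q relQ = Relevant-rename suc-injective (weaken d Q) (Relevant-weaken d Q relQ)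

Relevant-subAt : ∀ d Q M → Relevant Q → Relevant M → Relevant (subst (subAt d Q) M)
Relevant-subAt d Q (var i) relQ _ with subAt-var-or-weaken d Q i
... | inj₁ (k , eq) = transport Relevant (sym eq) tt
... | inj₂ eq       = transport Relevant (sym eq) (Relevant-weaken d Q relQ)
Relevant-subAt d Q (lam M) relQ (0∈M , relM) =
  transport (1 ≤_) (sym (occ-subAt (suc d) Q M 0)) (≤-trans 0∈M (m≤m+n _ _)) ,
  Relevant-subAt (suc d) Q M relQ relM
Relevant-subAt d Q (app M N) relQ (relM , relN) =
  Relevant-subAt d Q M relQ relM , Relevant-subAt d Q N relQ relN

∈FV-⟶ : ∀ {M N} → M ⟶ N → Relevant M → ∀ {i} → i ∈FV M → i ∈FV N
∈FV-⟶ (β {M} {N}) ((0∈M , _) , _) {i} i∈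
  rewrite occ-subAt 0 N M i with ∈FV-app⁻ (lam M) N i∈
... | inj₁ i∈M = ≤-trans i∈M (m≤m+n _ _)
... | inj₂ i∈N = ≤-trans (*-mono-≤ 0∈M i∈N) (m≤n+m _ _)
∈FV-⟶ (η {N}) _ {i} i∈ rewrite +-identityʳ (occ (suc i) (rename suc N)) | occ-weaken i N = i∈
∈FV-⟶ (ξlam s) (_ , relM) i∈ = ∈FV-⟶ s relM i∈
∈FV-⟶ (ξl {M} {M′} {N} s) (relM , _) i∈ with ∈FV-app⁻ M N i∈
... | inj₁ i∈M = ∈FV-appˡ M′ N (∈FV-⟶ s relM i∈M)
... | inj₂ i∈N = ∈FV-appʳ M′ N i∈N
∈FV-⟶ (ξr {M} {N} {N′} s) (_ , relN) i∈ with ∈FV-app⁻ M N i∈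
... | inj₁ i∈M = ∈FV-appˡ M N′ i∈M
... | inj₂ i∈N = ∈FV-appʳ M N′ (∈FV-⟶ s relN i∈N)

Relevant-⟶ : ∀ {M N} → M ⟶ N → Relevant M → Relevant N
Relevant-⟶ (β {M} {N}) ((_ , relM) , relN) = Relevant-subAt 0 N M relN relM
Relevant-⟶ (η {N}) (_ , relN , _)         = Relevant-rename⁻ suc-injective N relN
Relevant-⟶ (ξlam s) (0∈M , relM)          = ∈FV-⟶ s relM 0∈M , Relevant-⟶ s relM
Relevant-⟶ (ξl s) (relM , relN)           = Relevant-⟶ s relM , relN
Relevant-⟶ (ξr s) (relM , relN)           = relM , Relevant-⟶ s relN

∈FV-⟶* : ∀ {M N} → M ⟶* N → Relevant M → ∀ {i} → i ∈FV M → i ∈FV N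
∈FV-⟶* ε        _    i∈ = i∈
∈FV-⟶* (s ◅ ss) relM i∈ = ∈FV-⟶* ss (Relevant-⟶ s relM) (∈FV-⟶ s relM i∈)

erases⇒Closed : ∀ {E M} → Linear E → Linear M → app E M ⟶* I → Closed M
erases⇒Closed {E} {M} linearE linearM E-erases i with occ i M in eq
... | zero  = refl
... | suc _ = ⊥-elim (Closed⇒∉FV {I} Closed-I {i} (∈FV-⟶* E-erases relEM i∈EM))
  where
  relEM : Relevant (app E M)
  relEM = Linear⇒Relevant E linearE , Linear⇒Relevant M linearM
  i∈EM : i ∈FV app E M
  i∈EM = ∈FV-appʳ E M (≤-trans (s≤s z≤n) (≤-reflexive (sym eq)))

-- Closed linear terms

weaken-Closed : ∀ d {Q} → Closed Q → weaken d Q ≡ Q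
weaken-Closed zero    closed = refl
weaken-Closed (suc d) {Q} closed =
  trans (cong (rename suc) (weaken-Closed d closed))
        (rename-id-on-FV suc Q (λ i i∈ → ⊥-elim (Closed⇒∉FV {Q} closed i∈)))

occ-subAt-Closed : ∀ d {Q} → Closed Q → ∀ M j → occ j (subst (subAt d Q) M) ≡ occ (punchIn d j) M
occ-subAt-Closed d {Q} closed M j = begin
  occ j (subst (subAt d Q) M)                             ≡⟨ occ-subAt d Q M j ⟩
  occ (punchIn d j) M + occ d M * occ j (weaken d Q)      ≡⟨ cong (λ t → _ + occ d M * occ j t) (weaken-Closed d closed) ⟩
  occ (punchIn d j) M + occ d M * occ j Q                 ≡⟨ cong (λ t → _ + occ d M * t) (closed j) ⟩
  occ (punchIn d j) M + occ d M * 0                       ≡⟨ cong (occ (punchIn d j) M +_) (*-zeroʳ (occ d M)) ⟩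
  occ (punchIn d j) M + 0                                 ≡⟨ +-identityʳ _ ⟩
  occ (punchIn d j) M                                     ∎
  where open ≡-Reasoning

Linear-var : ∀ k → Linear (var k)
Linear-var k = (λ i → occ-var-≤1 i k) , tt

Linear-subAt : ∀ d {Q} → Closed Q → Linear Q → ∀ M → Linear M → Linear (subst (subAt d Q) M)
Linear-subAt d {Q} closedQ linearQ (var i) _ with subAt-var-or-weaken d Q i
... | inj₁ (k , eq) = transport Linear (sym eq) (Linear-var k)
... | inj₂ eq       = transport Linear (sym (trans eq (weaken-Closed d closedQ))) linearQ
Linear-subAt d closedQ linearQ (lam M) (bound , 0∈M , linearM) =
  (λ j → transport (_≤ 1) (sym (occ-subAt-Closed d closedQ (lam M) j)) (bound (punchIn d j))) ,
  transport (1 ≤_) (sym (occ-subAt-Closed (suc d) closedQ M 0)) 0∈M ,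
  Linear-subAt (suc d) closedQ linearQ M linearM
Linear-subAt d closedQ linearQ (app M N) linear@(bound , _) =
  (λ j → transport (_≤ 1) (sym (occ-subAt-Closed d closedQ (app M N) j)) (bound (punchIn d j))) ,
  proj₂ (Linear-subAt d closedQ linearQ M (Linear-appˡ {M} {N} linear)) ,
  proj₂ (Linear-subAt d closedQ linearQ N (Linear-appʳ {M} {N} linear))

Linear-app : ∀ {M N} → Closed (app M N) → Linear M → Linear N → Linear (app M N)
Linear-app closed (_ , okM) (_ , okN) = (λ i → m≤n⇒m≤1+n (≤-reflexive (closed i))) , okM , okN

Closed-[] : ∀ {B Q} → Closed (lam B) → Closed Q → Closed (B [ Q ])
Closed-[] {B} closedB closedQ j = trans (occ-subAt-Closed 0 closedQ B j) (closedB j)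

Linear-[] : ∀ {B Q} → Closed Q → Linear Q → Linear (lam B) → Linear (B [ Q ])
Linear-[] {B} closedQ linearQ (_ , _ , linearB) = Linear-subAt 0 closedQ linearQ B linearB

size-[] : ∀ {B} Q → Linear (lam B) → size (B [ Q ]) + 1 ≡ size B + size Q
size-[] {B} Q (_ , 0∈B , linearB) = begin
  size (B [ Q ]) + 1         ≡⟨ cong (size (B [ Q ]) +_) (sym occ≡1) ⟩
  size (B [ Q ]) + occ 0 B   ≡⟨ size-subAt 0 Q B ⟩
  size B + occ 0 B * size Q  ≡⟨ cong (λ o → size B + o * size Q) occ≡1 ⟩
  size B + 1 * size Q        ≡⟨ cong (size B +_) (*-identityˡ (size Q)) ⟩
  size B + size Q            ∎
  where
  open ≡-Reasoning
  occ≡1 : occ 0 B ≡ 1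
  occ≡1 = ≤-antisym (proj₁ linearB 0) 0∈B

size-[I] : ∀ {B} → Linear (lam B) → size (B [ I ]) ≡ size (lam B)
size-[I] {B} linear = +-cancelʳ-≡ 1 (size (B [ I ])) (size (lam B))
  (trans (size-[] I linear) (+-suc (size B) 1))

-- Applying I repeatedly

record ShrinkingStep (M : Λ) : Set where
  constructor shrinking
  field
    {reduct} : Λ
    step     : M ⟶ reduct
    smaller  : size reduct < size M
    closed   : Closed reduct
    linear   : Linear reduct

app-shrinks : ∀ M N → Closed (app M N) → Linear (app M N) → ShrinkingStep (app M N)
app-shrinks (var i) N closed _ = ⊥-elim (¬Closed-var (Closed-appˡ {var i} {N} closed))
app-shrinks (lam B) N closed linear =
  shrinking β (s≤s (m≤n⇒m≤1+n (≤-trans (m≤m+n _ 1) (≤-reflexive (size-[] N linearB)))))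
            (Closed-[] {B} {N} closedB closedN) (Linear-[] {B} {N} closedN linearN linearB)
  where
  closedB : Closed (lam B)
  closedB = Closed-appˡ {lam B} {N} closed
  closedN : Closed N
  closedN = Closed-appʳ {lam B} {N} closed
  linearB : Linear (lam B)
  linearB = Linear-appˡ {lam B} {N} linear
  linearN : Linear N
  linearN = Linear-appʳ {lam B} {N} linear
app-shrinks (app M₁ M₂) N closed linear
  with app-shrinks M₁ M₂ (Closed-appˡ {app M₁ M₂} {N} closed) (Linear-appˡ {app M₁ M₂} {N} linear)
... | shrinking {M′} step smaller closedM′ linearM′ =
  shrinking (ξl step) (s≤s (+-monoˡ-< (size N) smaller)) closed′
            (Linear-app closed′ linearM′ (Linear-appʳ {app M₁ M₂} {N} linear))
  where
  closed′ : Closed (app M′ N)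
  closed′ i = cong₂ _+_ (closedM′ i) (Closed-appʳ {app M₁ M₂} {N} closed i)

leadingλs : Λ → ℕ
leadingλs (lam M) = suc (leadingλs M)
leadingλs _       = 0

-- A relevant λ-body that is a variable is the bound one, which subst fixes.
leadingλs-subst : ∀ σ M → Relevant (lam M) → leadingλs (subst σ (lam M)) ≡ leadingλs (lam M)
leadingλs-subst σ (var zero)    _         = refl
leadingλs-subst σ (var (suc i)) (() , _)
leadingλs-subst σ (lam M)       (_ , rel) = cong suc (leadingλs-subst (exts σ) M rel)
leadingλs-subst σ (app M N)     _         = refl

infixl 5 _·I^_

_·I^_ : Λ → ℕ → Λ
M ·I^ zero  = M
M ·I^ suc n = app (M ·I^ n) I

·I^-⟶ : ∀ {M M′} n → M ⟶ M′ → M ·I^ n ⟶ M′ ·I^ n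
·I^-⟶ zero    s = s
·I^-⟶ (suc n) s = ξl (·I^-⟶ n s)

·I^-suc : ∀ M n → app M I ·I^ n ≡ M ·I^ suc n
·I^-suc M zero    = refl
·I^-suc M (suc n) = cong (λ t → app t I) (·I^-suc M n)

·I^-pad : ∀ {M n n′} → n ≤′ n′ → M ·I^ n ⟶* I → M ·I^ n′ ⟶* I
·I^-pad (≤′-reflexive refl) r = r
·I^-pad (≤′-step n≤n′)      r = gmap (λ t → app t I) ξl (·I^-pad n≤n′ r) ◅◅ β ◅ ε

Linear-I : Linear I
Linear-I = (λ _ → z≤n) , s≤s z≤n , Linear-var 0

feed-I : ∀ {B} → ∃[ n ] B [ I ] ·I^ n ⟶* I → ∃[ n ] lam B ·I^ n ⟶* I
feed-I {B} (n , r) = suc n , transport (_⟶* I) (·I^-suc (lam B) n) (·I^-⟶ n β ◅ r)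

-- Lexicographic induction on (size, leadingλs); size is a strict bound.
Closed-Linear⇒·I^⟶*I-bounded : ∀ s k M → size M < s → leadingλs M ≤ k →
                               Closed M → Linear M → ∃[ n ] M ·I^ n ⟶* I
Closed-Linear⇒·I^⟶*I-bounded (suc s) k (var i) _ _ closed _ = ⊥-elim (¬Closed-var closed)
Closed-Linear⇒·I^⟶*I-bounded (suc s) k (app M N) small _ closed linear
  with app-shrinks M N closed linear
... | shrinking {M′} step smaller closed′ linear′
  with Closed-Linear⇒·I^⟶*I-bounded s (leadingλs M′) M′ (≤-trans smaller (≤-pred small)) ≤-refl closed′ linear′
...   | n , r = n , (·I^-⟶ n step ◅ r)
Closed-Linear⇒·I^⟶*I-bounded (suc s) (suc k) (lam (var zero)) _ _ _ _ = 0 , ε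
Closed-Linear⇒·I^⟶*I-bounded (suc s) (suc k) (lam (var (suc i))) _ _ _ (_ , () , _)
Closed-Linear⇒·I^⟶*I-bounded (suc s) (suc k) (lam B@(lam C)) small (s≤s few) closed linear =
  feed-I (Closed-Linear⇒·I^⟶*I-bounded (suc s) k (B [ I ])
           (≤-trans (s≤s (≤-reflexive (size-[I] {B} linear))) small)
           (≤-trans (≤-reflexive (leadingλs-subst (sub0 I) C (proj₂ (Linear⇒Relevant (lam B) linear)))) few)
           (Closed-[] {B} {I} closed Closed-I) (Linear-[] {B} {I} Closed-I Linear-I linear))
Closed-Linear⇒·I^⟶*I-bounded (suc s) (suc k) (lam B@(app _ _)) small _ closed linear =
  feed-I (Closed-Linear⇒·I^⟶*I-bounded (suc s) k (B [ I ])
           (≤-trans (s≤s (≤-reflexive (size-[I] {B} linear))) small) z≤n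
           (Closed-[] {B} {I} closed Closed-I) (Linear-[] {B} {I} Closed-I Linear-I linear))

Closed-Linear⇒·I^⟶*I : ∀ {M} → Closed M → Linear M → ∃[ n ] M ·I^ n ⟶* I
Closed-Linear⇒·I^⟶*I {M} = Closed-Linear⇒·I^⟶*I-bounded (suc (size M)) (leadingλs M) M ≤-refl ≤-refl

common-·I^ : ∀ X → All Closed X → All Linear X → ∃[ n ] (∀ {M} → M ∈ X → M ·I^ n ⟶* I)
common-·I^ []      []             []             = 0 , λ ()
common-·I^ (M ∷ X) (closedM ∷ cX) (linearM ∷ lX)
  with Closed-Linear⇒·I^⟶*I closedM linearM | common-·I^ X cX lX
... | m , rM | n , rX = m ⊔ n , λ
  { (here refl) → ·I^-pad (≤⇒≤′ (m≤m⊔n m n)) rM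
  ; (there M∈X) → ·I^-pad (≤⇒≤′ (m≤n⊔m m n)) (rX M∈X)
  }

eraser : ℕ → Λ
eraser n = lam (var 0 ·I^ n)

occ-·I^ : ∀ i M n → occ i (M ·I^ n) ≡ occ i M
occ-·I^ i M zero    = refl
occ-·I^ i M (suc n) = trans (+-identityʳ _) (occ-·I^ i M n)

Linear-·I^ : ∀ {M} n → Linear M → Linear (M ·I^ n)
Linear-·I^     zero    linear = linear
Linear-·I^ {M} (suc n) linear =
  (λ i → transport (_≤ 1) (sym (occ-·I^ i M (suc n))) (proj₁ linear i)) ,
  proj₂ (Linear-·I^ n linear) , proj₂ Linear-I

Linear-eraser : ∀ n → Linear (eraser n)
Linear-eraser n =
  (λ i → m≤n⇒m≤1+n (≤-reflexive (occ-·I^ (suc i) (var 0) n))) ,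
  ≤-reflexive (sym (occ-·I^ 0 (var 0) n)) ,
  Linear-·I^ n (Linear-var 0)

subst-·I^ : ∀ σ M n → subst σ (M ·I^ n) ≡ subst σ M ·I^ n
subst-·I^ σ M zero    = refl
subst-·I^ σ M (suc n) = cong (λ t → app t I) (subst-·I^ σ M n)

eraser-⟶* : ∀ n M → app (eraser n) M ⟶* M ·I^ n
eraser-⟶* n M = transport (app (eraser n) M ⟶*_) (subst-·I^ (sub0 M) (var 0) n) (β ◅ ε)

proposition3p5 : (X : List Λ) → All Linear X → (Erasable X ⇔ All Closed X)
proposition3p5 X linearX = mk⇔ erasable⇒closed closed⇒erasable
  where
  erasable⇒closed : Erasable X → All Closed X
  erasable⇒closed (E , linearE , erases) =
    tabulate (λ M∈X → erases⇒Closed linearE (lookup linearX M∈X) (erases M∈X))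

  closed⇒erasable : All Closed X → Erasable X
  closed⇒erasable closedX with common-·I^ X closedX linearX
  ... | n , r = eraser n , Linear-eraser n , λ {M} M∈X → eraser-⟶* n M ◅◅ r M∈X
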